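{- Let $Q$ be an $s\times t$ $(0,1)$-matrix such that row $1$, row $s$, column $1$ and column $t$ each contain at least one $1$-entry, and let $m\ge 2s$, $n\ge 2t$. Then \[\mathrm{m}(m,n,Q)=mn-\bigl(|NW(Q)|+|SW(Q)|+|NE(Q)|+|SE(Q)|\bigr).\]
   Context: All matrices are $(0,1)$-matrices. An $m\times n$ matrix $A$ is $Q$-forcing if every $s\times t$ submatrix of $A$ (any $s$ rows and any $t$ columns, order kept) is entrywise $\ge Q$; $\mathrm{m}(m,n,Q)$ is the minimum number of $1$-entries of an $m\times n$ $Q$-forcing matrix. Corner functions: $NW(Q)$ is the set of positions $(i,j)$ with $Q_{i,j}=0$ such that no $1$-entry of $Q$ lies at a position $(i',j')$ with $i'\le i$, $j'\le j$; $SW(Q)$: same with $i'\ge i$, $j'\le j$; $NE(Q)$: same with $i'\le i$, $j'\ge j$; $SE(Q)$: same with $i'\ge i$, $j'\ge j$. $|X|$ denotes cardinality. -}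

module Defs where

open import Data.Nat using (ℕ; _+_; _≤ᵇ_; _<_; _≤_)
open import Data.Nat.ListAction using (sum)
open import Data.Bool using (Bool; true; false; not; _∧_; if_then_else_)
open import Data.Fin using (Fin; toℕ)
open import Data.List using (List; map; allFin)
open import Data.Bool.ListAction using (all)
open import Data.Product using (Σ; _×_)
open import Relation.Binary.PropositionalEquality using (_≡_)

Matrix : ℕ → ℕ → Set
Matrix m n = Fin m → Fin n → Bool

ones : ∀ {m n} → Matrix m n → ℕ
ones {m} {n} A = sum (map (λ i → sum (map (λ j → if A i j then 1 else 0) (allFin n))) (allFin m))

Increasing : ∀ {k m} → (Fin k → Fin m) → Set
Increasing f = ∀ i j → toℕ i < toℕ j → toℕ (f i) < toℕ (f j)

QForcing : ∀ {s t m n} → Matrix s t → Matrix m n → Set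
QForcing {s} {t} {m} {n} Q A =
  (r : Fin s → Fin m) (c : Fin t → Fin n) → Increasing r → Increasing c →
  ∀ i j → Q i j ≡ true → A (r i) (c j) ≡ true

-- k is the minimum number of 1-entries of an m × n Q-forcing matrix, i.e. k = m(m,n,Q).
IsMinForcing : ∀ {s t} → ℕ → ℕ → Matrix s t → ℕ → Set
IsMinForcing m n Q k =
  (Σ (Matrix m n) (λ A → QForcing Q A × (ones A ≡ k))) ×
  ((A : Matrix m n) → QForcing Q A → k ≤ ones A)

_≤F_ : ∀ {k} → Fin k → Fin k → Bool
i ≤F j = toℕ i ≤ᵇ toℕ j

corner : ∀ {s t} → (Fin s → Fin s → Bool) → (Fin t → Fin t → Bool) →
         Matrix s t → Matrix s t
corner {s} {t} rowRel colRel Q i j =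
  not (Q i j) ∧
  all (λ i' → all (λ j' → not (rowRel i' i ∧ colRel j' j ∧ Q i' j')) (allFin t)) (allFin s)

NW SW NE SE : ∀ {s t} → Matrix s t → Matrix s t
NW = corner (λ i' i → i' ≤F i) (λ j' j → j' ≤F j)
SW = corner (λ i' i → i ≤F i') (λ j' j → j' ≤F j)
NE = corner (λ i' i → i' ≤F i) (λ j' j → j ≤F j')
SE = corner (λ i' i → i ≤F i') (λ j' j → j ≤F j')

-- A position (r, c) of an m × n matrix is forced by a 1-entry (i, j) of Q when increasing
-- row and column maps can carry (i, j) to (r, c). The forced positions form a Q-forcing matrix
-- lying inside every Q-forcing matrix, so m(m,n,Q) is their number. For m ≥ 2s and n ≥ 2t a
-- middle row (s ≤ r < m − s) is reached from every row of Q, and every column is reached from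
-- the first or the last column of Q, both of which contain a 1; so the middle rows, and
-- symmetrically the middle columns, are entirely forced. In each of the four s × t corner blocks
-- the reachability conditions reduce to comparisons i′ ≤ i or i′ ≥ i, so the unforced positions
-- there are exactly NW(Q), SW(Q), NE(Q) and SE(Q).
module Submission where

open import Defs
open import Data.Nat using (ℕ; zero; suc; _+_; _*_; _∸_; _≤_; _<_; _≥_; _≤ᵇ_; _<?_; z≤n; s≤s; z<s)
open import Data.Nat.Properties
open import Data.Nat.Solver using (module +-*-Solver)
import Data.Nat.ListAction as List
open import Data.Bool using (Bool; true; false; not; _∧_; T; if_then_else_)
open import Data.Bool.ListAction using (all; any; or)
open import Data.Bool.Properties using (T-≡; T-∧)
open import Data.Fin using (Fin; zero; suc; toℕ; fromℕ; fromℕ<; _↑ˡ_; _↑ʳ_)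
open import Data.Fin.Properties using (toℕ<n; toℕ-fromℕ; toℕ-fromℕ<; toℕ-injective; toℕ-↑ˡ; toℕ-↑ʳ)
open import Data.List using (allFin; map; tabulate)
open import Data.List.Properties using (map-tabulate; map-cong)
import Data.List.Relation.Unary.All.Properties as All
import Data.List.Relation.Unary.Any.Properties as Any
open import Data.Product using (∃; ∃₂; _×_; _,_; proj₁; proj₂)
open import Function using (_∘_; id; _⇔_; mk⇔; Equivalence)
open import Relation.Binary.PropositionalEquality
open import Relation.Nullary using (¬_; yes; no)
open import Relation.Nullary.Reflects using (fromEquivalence; det; T-reflects; ¬-reflects)
open import Algebra.Properties.CommutativeMonoid.Sum +-0-commutativeMonoid
  using (sum; sum-syntax; sum-cong-≗; ∑-distrib-+)
open import Algebra.Properties.CommutativeSemigroup +-commutativeSemigroup using (interchange)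

open Equivalence using (to; from)

T-⇔→≡ : ∀ {a b} → T a ⇔ T b → a ≡ b
T-⇔→≡ {b = b} a⇔b = det (fromEquivalence (to a⇔b) (from a⇔b)) (T-reflects b)

T-not : ∀ {b} → T (not b) ⇔ (¬ T b)
T-not {true}  = mk⇔ (λ ()) (λ ¬t → ¬t _)
T-not {false} = mk⇔ (λ _ ()) _

T-all-allFin : ∀ {n} {p : Fin n → Bool} → T (all p (allFin n)) ⇔ (∀ i → T (p i))
T-all-allFin {p = p} = mk⇔ (All.tabulate⁻ ∘ All.all⁺ p _) (All.all⁻ p ∘ All.tabulate⁺)

T-any-allFin : ∀ {n} {p : Fin n → Bool} → T (any p (allFin n)) ⇔ ∃ λ i → T (p i)
T-any-allFin {p = p} =
  mk⇔ (Any.tabulate⁻ ∘ Any.any⁻ p _) (λ (i , pᵢ) → Any.any⁺ p (Any.tabulate⁺ i pᵢ))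

≤F-refl : ∀ {n} (i : Fin n) → T (i ≤F i)
≤F-refl i = ≤⇒≤ᵇ (≤-refl {toℕ i})

indicator : Bool → ℕ
indicator b = if b then 1 else 0

indicator-mono : ∀ {a b} → (a ≡ true → b ≡ true) → indicator a ≤ indicator b
indicator-mono {false} _   = z≤n
indicator-mono {true}  a⇒b = ≤-reflexive (cong indicator (sym (a⇒b refl)))

indicator-+-not : ∀ b → indicator b + indicator (not b) ≡ 1
indicator-+-not false = refl
indicator-+-not true  = refl

sum-tabulate : ∀ {n} (f : Fin n → ℕ) → List.sum (tabulate f) ≡ sum f
sum-tabulate {zero}  f = refl
sum-tabulate {suc n} f = cong (f zero +_) (sum-tabulate (f ∘ suc))

sum-allFin : ∀ {n} (f : Fin n → ℕ) → List.sum (map f (allFin n)) ≡ sum f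
sum-allFin f = trans (cong List.sum (map-tabulate id f)) (sum-tabulate f)

sum-mono-≤ : ∀ {n} {f g : Fin n → ℕ} → (∀ i → f i ≤ g i) → sum f ≤ sum g
sum-mono-≤ {zero}  _   = z≤n
sum-mono-≤ {suc n} f≤g = +-mono-≤ (f≤g zero) (sum-mono-≤ (f≤g ∘ suc))

sum-const : ∀ n {c} → ∑[ i < n ] c ≡ n * c
sum-const zero    = refl
sum-const (suc n) = cong (_ +_) (sum-const n)

sum-zero : ∀ {n} {f : Fin n → ℕ} → (∀ i → f i ≡ 0) → sum f ≡ 0
sum-zero {n} f≡0 = trans (sum-cong-≗ f≡0) (trans (sum-const n) (*-zeroʳ n))

sum-↑ : ∀ a {b} (f : Fin (a + b) → ℕ) → sum f ≡ sum (f ∘ (_↑ˡ b)) + sum (f ∘ (a ↑ʳ_))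
sum-↑ zero    f = refl
sum-↑ (suc a) {b} f =
  trans (cong (f zero +_) (sum-↑ a (f ∘ suc))) (sym (+-assoc (f zero) (sum (f ∘ suc ∘ (_↑ˡ b))) _))

ones-as-sum : ∀ {m n} (A : Matrix m n) → ones A ≡ ∑[ i < m ] ∑[ j < n ] indicator (A i j)
ones-as-sum {m} {n} A =
  trans (sum-allFin (λ i → List.sum (map (a i) (allFin n)))) (sum-cong-≗ {m} (λ i → sum-allFin (a i)))
  where
  a : Fin m → Fin n → ℕ
  a i j = indicator (A i j)

ones-mono : ∀ {m n} (A B : Matrix m n) → (∀ i j → A i j ≡ true → B i j ≡ true) → ones A ≤ ones B
ones-mono {m} {n} A B A⇒B = begin
  ones A                                   ≡⟨ ones-as-sum A ⟩
  ∑[ i < m ] ∑[ j < n ] indicator (A i j)  ≤⟨ sum-mono-≤ (λ i → sum-mono-≤ (λ j → indicator-mono (A⇒B i j))) ⟩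
  ∑[ i < m ] ∑[ j < n ] indicator (B i j)  ≡⟨ ones-as-sum B ⟨
  ones B                                   ∎
  where open ≤-Reasoning

ones-+-ones-not : ∀ {m n} (A : Matrix m n) → ones A + ones (λ i j → not (A i j)) ≡ m * n
ones-+-ones-not {m} {n} A = begin
  ones A + ones Ā                                      ≡⟨ cong₂ _+_ (ones-as-sum A) (ones-as-sum Ā) ⟩
  ∑[ i < m ] sum (a i) + ∑[ i < m ] sum (ā i)          ≡⟨ ∑-distrib-+ (sum ∘ a) (sum ∘ ā) ⟨
  ∑[ i < m ] (sum (a i) + sum (ā i))                   ≡⟨ sum-cong-≗ {m} (λ i → ∑-distrib-+ (a i) (ā i)) ⟨
  ∑[ i < m ] ∑[ j < n ] (a i j + ā i j)                ≡⟨ sum-cong-≗ {m} (λ i → sum-cong-≗ {n} (λ j → indicator-+-not (A i j))) ⟩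
  ∑[ i < m ] ∑[ j < n ] 1                              ≡⟨ sum-cong-≗ {m} (λ i → trans (sum-const n) (*-identityʳ n)) ⟩
  ∑[ i < m ] n                                         ≡⟨ sum-const m ⟩
  m * n                                                ∎
  where
  open ≡-Reasoning
  Ā : Matrix m n
  Ā i j = not (A i j)
  a ā : Fin m → Fin n → ℕ
  a i j = indicator (A i j)
  ā i j = indicator (Ā i j)

module Blocks (a d b : ℕ) where

  lo : Fin a → Fin (a + (d + b))
  lo i = i ↑ˡ (d + b)

  mid : Fin d → Fin (a + (d + b))
  mid k = a ↑ʳ (k ↑ˡ b)

  hi : Fin b → Fin (a + (d + b))
  hi k = a ↑ʳ (d ↑ʳ k)

  toℕ-lo : ∀ i → toℕ (lo i) ≡ toℕ i
  toℕ-lo i = toℕ-↑ˡ i (d + b)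

  toℕ-mid : ∀ k → toℕ (mid k) ≡ a + toℕ k
  toℕ-mid k = trans (toℕ-↑ʳ a (k ↑ˡ b)) (cong (a +_) (toℕ-↑ˡ k b))

  toℕ-hi : ∀ k → toℕ (hi k) ≡ a + (d + toℕ k)
  toℕ-hi k = trans (toℕ-↑ʳ a (d ↑ʳ k)) (cong (a +_) (toℕ-↑ʳ d k))

  sum-frame : (f : Fin (a + (d + b)) → ℕ) → (∀ k → f (mid k) ≡ 0) →
              sum f ≡ sum (f ∘ lo) + sum (f ∘ hi)
  sum-frame f mid≡0 = begin
    sum f                                         ≡⟨ sum-↑ a f ⟩
    sum (f ∘ lo) + sum (f ∘ (a ↑ʳ_))              ≡⟨ cong (sum (f ∘ lo) +_) (sum-↑ d (f ∘ (a ↑ʳ_))) ⟩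
    sum (f ∘ lo) + (sum (f ∘ mid) + sum (f ∘ hi)) ≡⟨ cong (λ z → sum (f ∘ lo) + (z + sum (f ∘ hi))) (sum-zero mid≡0) ⟩
    sum (f ∘ lo) + sum (f ∘ hi)                   ∎
    where open ≡-Reasoning

increasing-suc : ∀ {k M} {f : Fin (suc k) → Fin M} → Increasing f → Increasing (f ∘ suc)
increasing-suc f↑ i j = f↑ (suc i) (suc j) ∘ s≤s

increasing-from-first : ∀ {k M} (f : Fin (suc k) → Fin M) → Increasing f →
                        ∀ i → toℕ (f zero) + toℕ i ≤ toℕ (f i)
increasing-from-first f f↑ zero = ≤-reflexive (+-identityʳ (toℕ (f zero)))
increasing-from-first {suc k} f f↑ (suc i) = begin
  toℕ (f zero) + suc (toℕ i)  ≡⟨ +-suc (toℕ (f zero)) (toℕ i) ⟩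
  suc (toℕ (f zero)) + toℕ i  ≤⟨ +-monoˡ-≤ (toℕ i) (f↑ zero (suc zero) z<s) ⟩
  toℕ (f (suc zero)) + toℕ i  ≤⟨ increasing-from-first (f ∘ suc) (increasing-suc f↑) i ⟩
  toℕ (f (suc i))             ∎
  where open ≤-Reasoning

increasing-index≤ : ∀ {k M} (f : Fin k → Fin M) → Increasing f → ∀ i → toℕ i ≤ toℕ (f i)
increasing-index≤ {suc k} f f↑ i = ≤-trans (m≤n+m (toℕ i) (toℕ (f zero))) (increasing-from-first f f↑ i)

increasing-room : ∀ {k M} (f : Fin k → Fin M) → Increasing f → ∀ i → toℕ (f i) + k ≤ toℕ i + M
increasing-room {suc zero} {M} f f↑ zero = begin
  toℕ (f zero) + 1    ≡⟨ +-comm (toℕ (f zero)) 1 ⟩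
  suc (toℕ (f zero))  ≤⟨ toℕ<n (f zero) ⟩
  M                   ∎
  where open ≤-Reasoning
increasing-room {suc (suc k)} {M} f f↑ zero = begin
  toℕ (f zero) + suc (suc k)  ≡⟨ +-suc (toℕ (f zero)) (suc k) ⟩
  suc (toℕ (f zero)) + suc k  ≤⟨ +-monoˡ-≤ (suc k) (f↑ zero (suc zero) z<s) ⟩
  toℕ (f (suc zero)) + suc k  ≤⟨ increasing-room (f ∘ suc) (increasing-suc f↑) zero ⟩
  M                           ∎
  where open ≤-Reasoning
increasing-room {suc k} {M} f f↑ (suc i) = begin
  toℕ (f (suc i)) + suc k    ≡⟨ +-suc (toℕ (f (suc i))) k ⟩
  suc (toℕ (f (suc i)) + k)  ≤⟨ s≤s (increasing-room (f ∘ suc) (increasing-suc f↑) i) ⟩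
  suc (toℕ i + M)            ∎
  where open ≤-Reasoning

-- Position i of a chain of length S can go to position x of a chain of length M under an
-- increasing map iff i ≤ x and S − i ≤ M − x.
window : (S M i x : ℕ) → Bool
window S M i x = (i ≤ᵇ x) ∧ (x + S ≤ᵇ i + M)

T-window : ∀ {S M i x} → T (window S M i x) ⇔ (i ≤ x × x + S ≤ i + M)
T-window {S} {M} {i} {x} = mk⇔
  (λ w → let i≤x , fits = to (T-∧ {i ≤ᵇ x}) w in ≤ᵇ⇒≤ i x i≤x , ≤ᵇ⇒≤ (x + S) (i + M) fits)
  (λ (i≤x , fits) → from T-∧ (≤⇒≤ᵇ i≤x , ≤⇒≤ᵇ fits))

_⇝_ : ∀ {S M} → Fin S → Fin M → Bool
_⇝_ {S} {M} i x = window S M (toℕ i) (toℕ x)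

increasing⇒⇝ : ∀ {S M} (f : Fin S → Fin M) → Increasing f → ∀ i → T (i ⇝ f i)
increasing⇒⇝ f f↑ i = from T-window (increasing-index≤ f f↑ i , increasing-room f f↑ i)

⇝⇒increasing : ∀ {S M} (i : Fin S) (x : Fin M) → T (i ⇝ x) →
                     ∃ λ f → Increasing f × f i ≡ x
⇝⇒increasing {S} {M} i x w = shift , shift-increasing , toℕ-injective (trans (toℕ-fromℕ< _) i+δ≡x)
  where
  bounds : toℕ i ≤ toℕ x × toℕ x + S ≤ toℕ i + M
  bounds = to T-window w
  i≤x = proj₁ bounds
  fits = proj₂ bounds
  δ = toℕ x ∸ toℕ i
  i+δ≡x : toℕ i + δ ≡ toℕ x
  i+δ≡x = m+[n∸m]≡n i≤x
  room : δ + S ≤ M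
  room = +-cancelˡ-≤ (toℕ i) (δ + S) M (begin
    toℕ i + (δ + S)  ≡⟨ +-assoc (toℕ i) δ S ⟨
    toℕ i + δ + S    ≡⟨ cong (_+ S) i+δ≡x ⟩
    toℕ x + S        ≤⟨ fits ⟩
    toℕ i + M        ∎)
    where open ≤-Reasoning
  bound : ∀ a → toℕ a + δ < M
  bound a = begin-strict
    toℕ a + δ  ≡⟨ +-comm (toℕ a) δ ⟩
    δ + toℕ a  <⟨ +-monoʳ-< δ (toℕ<n a) ⟩
    δ + S      ≤⟨ room ⟩
    M          ∎
    where open ≤-Reasoning
  shift : Fin S → Fin M
  shift a = fromℕ< (bound a)
  shift-increasing : Increasing shift
  shift-increasing a b a<b =
    subst₂ _<_ (sym (toℕ-fromℕ< (bound a))) (sym (toℕ-fromℕ< (bound b))) (+-monoˡ-< δ a<b)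

hits : ∀ {S U} → (Fin S → Bool) → (Fin U → Bool) → Matrix S U → Bool
hits {S} {U} R C Q = any (λ i → any (λ j → R i ∧ C j ∧ Q i j) (allFin U)) (allFin S)

Hit : ∀ {S U} → (Fin S → Bool) → (Fin U → Bool) → Matrix S U → Set
Hit R C Q = ∃₂ λ i j → T (R i ∧ C j ∧ Q i j)

T-hits : ∀ {S U} (R : Fin S → Bool) (C : Fin U → Bool) (Q : Matrix S U) → T (hits R C Q) ⇔ Hit R C Q
T-hits R C Q = mk⇔
  (λ h → let i , hᵢ = to T-any-allFin h in i , to T-any-allFin hᵢ)
  (λ (i , j , hᵢⱼ) → from T-any-allFin (i , from T-any-allFin (j , hᵢⱼ)))

hits-cong : ∀ {S U} {R R′ : Fin S → Bool} {C C′ : Fin U → Bool} (Q : Matrix S U) →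
            R ≗ R′ → C ≗ C′ → hits R C Q ≡ hits R′ C′ Q
hits-cong {S} {U} Q R≗R′ C≗C′ = cong or (map-cong (λ i → cong or (map-cong (λ j →
  cong₂ _∧_ (R≗R′ i) (cong (_∧ Q i j) (C≗C′ j))) (allFin U))) (allFin S))

corner-≡-not-hits : ∀ {S U} {R : Fin S → Fin S → Bool} {C : Fin U → Fin U → Bool} (Q : Matrix S U) →
                    (∀ i → T (R i i)) → (∀ j → T (C j j)) →
                    ∀ i j → corner R C Q i j ≡ not (hits (λ i′ → R i′ i) (λ j′ → C j′ j) Q)
corner-≡-not-hits {S} {U} {R} {C} Q R-refl C-refl i j =
  det (fromEquivalence sound complete) (¬-reflects (fromEquivalence (to hits⇔) (from hits⇔)))
  where
  Rᵢ : Fin S → Bool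
  Rᵢ i′ = R i′ i
  Cⱼ : Fin U → Bool
  Cⱼ j′ = C j′ j
  hits⇔ = T-hits Rᵢ Cⱼ Q
  sound : T (corner R C Q i j) → ¬ Hit Rᵢ Cⱼ Q
  sound c (i′ , j′ , h) =
    to T-not (to T-all-allFin (to T-all-allFin (proj₂ (to (T-∧ {not (Q i j)}) c)) i′) j′) h
  complete : ¬ Hit Rᵢ Cⱼ Q → T (corner R C Q i j)
  complete ¬hit = from T-∧
    ( from T-not (λ q → ¬hit (i , j , from T-∧ (R-refl i , from T-∧ (C-refl j , q))))
    , from T-all-allFin (λ i′ → from T-all-allFin (λ j′ → from T-not (λ h → ¬hit (i′ , j′ , h)))))

minForcing : ∀ {S U} → Matrix S U → (M N : ℕ) → Matrix M N
minForcing Q M N r c = hits (_⇝ r) (_⇝ c) Q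

module _ {S U} (Q : Matrix S U) (M N : ℕ) where

  minForcing-intro : ∀ {r c} i j → T (i ⇝ r) → T (j ⇝ c) → Q i j ≡ true → minForcing Q M N r c ≡ true
  minForcing-intro {r} {c} i j wᵢ wⱼ qᵢⱼ =
    to T-≡ (from (T-hits (_⇝ r) (_⇝ c) Q) (i , j , from T-∧ (wᵢ , from T-∧ (wⱼ , from T-≡ qᵢⱼ))))

  minForcing-forcing : QForcing Q (minForcing Q M N)
  minForcing-forcing ρ γ ρ↑ γ↑ i j =
    minForcing-intro i j (increasing⇒⇝ ρ ρ↑ i) (increasing⇒⇝ γ γ↑ j)

  minForcing-least : (A : Matrix M N) → QForcing Q A →
                     ∀ r c → minForcing Q M N r c ≡ true → A r c ≡ true
  minForcing-least A A-forcing r c forced =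
    let i , j , h     = to (T-hits (_⇝ r) (_⇝ c) Q) (from T-≡ forced)
        wᵢ , h′       = to (T-∧ {i ⇝ r}) h
        wⱼ , qᵢⱼ      = to (T-∧ {j ⇝ c}) h′
        ρ , ρ↑ , ρᵢ≡r = ⇝⇒increasing i r wᵢ
        γ , γ↑ , γⱼ≡c = ⇝⇒increasing j c wⱼ
    in subst₂ (λ r c → A r c ≡ true) ρᵢ≡r γⱼ≡c (A-forcing ρ γ ρ↑ γ↑ i j (to T-≡ qᵢⱼ))

  minForcing-isMin : IsMinForcing M N Q (ones (minForcing Q M N))
  minForcing-isMin =
    (minForcing Q M N , minForcing-forcing , refl) ,
    λ A A-forcing → ones-mono (minForcing Q M N) A (minForcing-least A A-forcing)

  corner-≡-not-minForcing : ∀ {R : Fin S → Fin S → Bool} {C : Fin U → Fin U → Bool}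
    (ρ : Fin S → Fin M) (γ : Fin U → Fin N) →
    (∀ i′ i → (i′ ⇝ ρ i) ≡ R i′ i) → (∀ j′ j → (j′ ⇝ γ j) ≡ C j′ j) →
    (∀ i → T (R i i)) → (∀ j → T (C j j)) →
    ∀ i j → corner R C Q i j ≡ not (minForcing Q M N (ρ i) (γ j))
  corner-≡-not-minForcing {R} {C} ρ γ ρ-window γ-window R-refl C-refl i j =
    trans (corner-≡-not-hits {R = R} {C} Q R-refl C-refl i j)
          (cong not (hits-cong Q (λ i′ → sym (ρ-window i′ i)) (λ j′ → sym (γ-window j′ j))))

module Chain (S d : ℕ) where

  open Blocks S d S public

  private
    M = S + (d + S)

  window-front : ∀ {i r} → r < S → window S M i r ≡ (i ≤ᵇ r)
  window-front {i} {r} r<S = T-⇔→≡ (mk⇔ (λ w → ≤⇒≤ᵇ (proj₁ (to (T-window {S} {M} {i}) w)))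
                                         (λ i≤r → from T-window (≤ᵇ⇒≤ i r i≤r , fits)))
    where
    fits : r + S ≤ i + M
    fits = begin
      r + S  ≤⟨ +-monoˡ-≤ S (<⇒≤ r<S) ⟩
      S + S  ≤⟨ +-monoʳ-≤ S (m≤n+m S d) ⟩
      M      ≤⟨ m≤n+m M i ⟩
      i + M  ∎
      where open ≤-Reasoning

  window-back : ∀ {i k} → i < S → window S M i (S + (d + k)) ≡ (k ≤ᵇ i)
  window-back {i} {k} i<S = T-⇔→≡ (mk⇔
    (λ w → ≤⇒≤ᵇ (+-cancelʳ-≤ M k i (subst (_≤ i + M) shape (proj₂ (to (T-window {S} {M} {i}) w)))))
    (λ k≤i → from T-window ( ≤-trans (<⇒≤ i<S) (m≤m+n S (d + k))
                            , subst (_≤ i + M) (sym shape) (+-monoˡ-≤ M (≤ᵇ⇒≤ k i k≤i)))))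
    where
    open +-*-Solver
    shape : S + (d + k) + S ≡ k + M
    shape = solve 3 (λ S d k → S :+ (d :+ k) :+ S := k :+ (S :+ (d :+ S))) refl S d k

  window-middle : ∀ {i k} → i < S → k < d → T (window S M i (S + k))
  window-middle {i} {k} i<S k<d = from T-window (≤-trans (<⇒≤ i<S) (m≤m+n S k) , fits)
    where
    fits : S + k + S ≤ i + M
    fits = begin
      S + k + S    ≡⟨ +-assoc S k S ⟩
      S + (k + S)  ≤⟨ +-monoʳ-≤ S (+-monoˡ-≤ S (<⇒≤ k<d)) ⟩
      M            ≤⟨ m≤n+m M i ⟩
      i + M        ∎
      where open ≤-Reasoning

  window-lo : ∀ (i′ i : Fin S) → (i′ ⇝ lo i) ≡ (i′ ≤F i)
  window-lo i′ i = trans (cong (window S M (toℕ i′)) (toℕ-lo i)) (window-front {toℕ i′} (toℕ<n i))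

  window-hi : ∀ (i′ i : Fin S) → (i′ ⇝ hi i) ≡ (i ≤F i′)
  window-hi i′ i = trans (cong (window S M (toℕ i′)) (toℕ-hi i)) (window-back (toℕ<n i′))

  window-mid : ∀ (i : Fin S) k → T (i ⇝ mid k)
  window-mid i k = subst (T ∘ window S M (toℕ i)) (sym (toℕ-mid k)) (window-middle (toℕ<n i) (toℕ<n k))

reached-from-ends : ∀ {s d} {P : Fin (suc s) → Set} → P zero → P (fromℕ s) →
                    ∀ (x : Fin (suc s + (d + suc s))) → ∃ λ i → P i × T (i ⇝ x)
reached-from-ends {s} {d} P₀ Pₛ x with toℕ x <? suc s
... | yes x<S = zero , P₀ , subst T (sym (Chain.window-front (suc s) d {0} x<S)) _
... | no  x≮S = fromℕ s , Pₛ , subst (λ z → T (window (suc s) M z (toℕ x))) (sym (toℕ-fromℕ s))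
                                     (from T-window (<⇒≤ (≮⇒≥ x≮S) , fits))
  where
  M = suc s + (d + suc s)
  fits : toℕ x + suc s ≤ s + M
  fits = begin
    toℕ x + suc s   ≡⟨ +-suc (toℕ x) s ⟩
    suc (toℕ x) + s ≤⟨ +-monoˡ-≤ s (toℕ<n x) ⟩
    M + s           ≡⟨ +-comm M s ⟩
    s + M           ∎
    where open ≤-Reasoning

module Counting {s t : ℕ} (d e : ℕ) (Q : Matrix (suc s) (suc t))
  (top : ∃ λ j → Q zero j ≡ true) (bottom : ∃ λ j → Q (fromℕ s) j ≡ true)
  (left : ∃ λ i → Q i zero ≡ true) (right : ∃ λ i → Q i (fromℕ t) ≡ true) where

  S = suc s
  U = suc t
  M = S + (d + S)
  N = U + (e + U)

  module Row = Chain S d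
  module Col = Chain U e

  A* : Matrix M N
  A* = minForcing Q M N

  middle-row-forced : ∀ k c → A* (Row.mid k) c ≡ true
  middle-row-forced k c =
    let j , (i , qᵢⱼ) , wⱼ = reached-from-ends {P = λ j → ∃ λ i → Q i j ≡ true} left right c
    in minForcing-intro Q M N i j (Row.window-mid i k) wⱼ qᵢⱼ

  middle-column-forced : ∀ r k → A* r (Col.mid k) ≡ true
  middle-column-forced r k =
    let i , (j , qᵢⱼ) , wᵢ = reached-from-ends {P = λ i → ∃ λ j → Q i j ≡ true} top bottom r
    in minForcing-intro Q M N i j wᵢ (Col.window-mid j k) qᵢⱼ

  unforced : Fin M → Fin N → ℕ
  unforced r c = indicator (not (A* r c))

  block-sum : (Fin S → Fin M) → (Fin U → Fin N) → ℕ
  block-sum ρ γ = ∑[ i < S ] ∑[ j < U ] unforced (ρ i) (γ j)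

  ones-corner : ∀ {R : Fin S → Fin S → Bool} {C : Fin U → Fin U → Bool} ρ γ →
    (∀ i′ i → (i′ ⇝ ρ i) ≡ R i′ i) → (∀ j′ j → (j′ ⇝ γ j) ≡ C j′ j) →
    (∀ i → T (R i i)) → (∀ j → T (C j j)) → ones (corner R C Q) ≡ block-sum ρ γ
  ones-corner {R} {C} ρ γ ρ-window γ-window R-refl C-refl =
    trans (ones-as-sum (corner R C Q)) (sum-cong-≗ {S} λ i → sum-cong-≗ {U} λ j →
      cong indicator (corner-≡-not-minForcing Q M N ρ γ ρ-window γ-window R-refl C-refl i j))

  rows-sum : (ρ : Fin S → Fin M) →
             ∑[ i < S ] ∑[ c < N ] unforced (ρ i) c ≡ block-sum ρ Col.lo + block-sum ρ Col.hi
  rows-sum ρ = trans (sum-cong-≗ {S} (λ i → Col.sum-frame (unforced (ρ i))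
                       (λ k → cong (indicator ∘ not) (middle-column-forced (ρ i) k))))
                     (∑-distrib-+ (λ i → ∑[ j < U ] unforced (ρ i) (Col.lo j))
                                  (λ i → ∑[ j < U ] unforced (ρ i) (Col.hi j)))

  ones-unforced : ones (λ r c → not (A* r c)) ≡ ones (NW Q) + ones (SW Q) + ones (NE Q) + ones (SE Q)
  ones-unforced = begin
    ones (λ r c → not (A* r c))
      ≡⟨ ones-as-sum (λ r c → not (A* r c)) ⟩
    ∑[ r < M ] ∑[ c < N ] unforced r c
      ≡⟨ Row.sum-frame (λ r → ∑[ c < N ] unforced r c)
                       (λ k → sum-zero (λ c → cong (indicator ∘ not) (middle-row-forced k c))) ⟩
    ∑[ i < S ] ∑[ c < N ] unforced (Row.lo i) c + ∑[ i < S ] ∑[ c < N ] unforced (Row.hi i) c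
      ≡⟨ cong₂ _+_ (rows-sum Row.lo) (rows-sum Row.hi) ⟩
    (block-sum Row.lo Col.lo + block-sum Row.lo Col.hi) + (block-sum Row.hi Col.lo + block-sum Row.hi Col.hi)
      ≡⟨ cong₂ _+_ (cong₂ _+_ nw ne) (cong₂ _+_ sw se) ⟨
    (ones (NW Q) + ones (NE Q)) + (ones (SW Q) + ones (SE Q))
      ≡⟨ interchange (ones (NW Q)) (ones (NE Q)) (ones (SW Q)) (ones (SE Q)) ⟩
    (ones (NW Q) + ones (SW Q)) + (ones (NE Q) + ones (SE Q))
      ≡⟨ +-assoc (ones (NW Q) + ones (SW Q)) (ones (NE Q)) (ones (SE Q)) ⟨
    ones (NW Q) + ones (SW Q) + ones (NE Q) + ones (SE Q) ∎
    where
    open ≡-Reasoning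
    nw = ones-corner Row.lo Col.lo Row.window-lo Col.window-lo ≤F-refl ≤F-refl
    ne = ones-corner Row.lo Col.hi Row.window-lo Col.window-hi ≤F-refl ≤F-refl
    sw = ones-corner Row.hi Col.lo Row.window-hi Col.window-lo ≤F-refl ≤F-refl
    se = ones-corner Row.hi Col.hi Row.window-hi Col.window-hi ≤F-refl ≤F-refl

  ones-minForcing : ones A* ≡ M * N ∸ (ones (NW Q) + ones (SW Q) + ones (NE Q) + ones (SE Q))
  ones-minForcing = begin
    ones A*                       ≡⟨ m+n∸n≡m (ones A*) (ones Ā) ⟨
    ones A* + ones Ā ∸ ones Ā     ≡⟨ cong₂ _∸_ (ones-+-ones-not A*) ones-unforced ⟩
    M * N ∸ (ones (NW Q) + ones (SW Q) + ones (NE Q) + ones (SE Q)) ∎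
    where
    open ≡-Reasoning
    Ā : Matrix M N
    Ā r c = not (A* r c)

≥2*-split : ∀ {m k} → m ≥ 2 * k → ∃ λ d → m ≡ k + (d + k)
≥2*-split {m} {k} m≥2k with m≤n⇒∃[o]m+o≡n m≥2k
... | d , 2k+d≡m = d , (begin
  m            ≡⟨ 2k+d≡m ⟨
  2 * k + d    ≡⟨ cong (λ z → k + z + d) (+-identityʳ k) ⟩
  k + k + d    ≡⟨ +-assoc k k d ⟩
  k + (k + d)  ≡⟨ cong (k +_) (+-comm k d) ⟩
  k + (d + k)  ∎)
  where open ≡-Reasoning

corollary3 : (s t : ℕ) (Q : Matrix (suc s) (suc t)) (m n : ℕ) →
    (∃ λ j → Q zero j ≡ true) → (∃ λ j → Q (fromℕ s) j ≡ true) →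
    (∃ λ i → Q i zero ≡ true) → (∃ λ i → Q i (fromℕ t) ≡ true) →
    m ≥ 2 * suc s → n ≥ 2 * suc t →
    IsMinForcing m n Q (m * n ∸ (ones (NW Q) + ones (SW Q) + ones (NE Q) + ones (SE Q)))
corollary3 s t Q m n top bottom left right m≥ n≥
  with d , refl ← ≥2*-split {k = suc s} m≥ | e , refl ← ≥2*-split {k = suc t} n≥ =
  subst (IsMinForcing _ _ Q) (Counting.ones-minForcing d e Q top bottom left right) (minForcing-isMin Q _ _)
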